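{- Fix $w \in W$. (i) If $w$ is $321$-avoiding then all the sets $X_i$ in the definition of $d_k(w)$ satisfy $|X_i| \leq 2$. (ii) If $w$ is not $321$-avoiding then $d_1(w) \geq 3$.
   Context: Let $n \geq 3$ and let $W$ be the affine Weyl group of type $\widetilde A_{n-1}$, realized as the group of permutations $w$ of $\mathbb{Z}$ with $w(i+n) = w(i)+n$ and $\sum_{t=1}^n w(t) = \sum_{t=1}^n t$. An element $w$ is $321$-avoiding if there are no integers $a<b<c$ with $w(a)>w(b)>w(c)$. For $k \geq 1$, $d_k(w) := \max\{|X| : X = \bigcup_{i=1}^k X_i \subset \mathbb{Z}\}$, where the union is disjoint, no two integers of $X$ are congruent modulo $n$, and whenever $X_i$ contains $u<v$ we have $w(u) > w(v)$. -}

module Defs where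

open import Data.Nat using (ℕ; zero; suc)
open import Data.Integer using (ℤ; +_; _+_; _-_; _<_)
open import Data.Integer.Divisibility using (_∣_)
open import Data.Fin using (Fin)
open import Data.List using (List; length; concat; tabulate)
open import Data.List.Membership.Propositional using (_∈_)
open import Data.List.Relation.Unary.AllPairs using (AllPairs)
open import Data.Product using (_×_; ∃)
open import Relation.Binary.PropositionalEquality using (_≡_)
open import Relation.Nullary using (¬_)
open import Function.Definitions using (Bijective)

sumFrom1 : (ℤ → ℤ) → ℕ → ℤ
sumFrom1 f zero = + 0
sumFrom1 f (suc m) = sumFrom1 f m + f (+ suc m)

-- w is an element of the affine Weyl group of type Ã_{n-1}
-- (affine permutation of ℤ with window sum Σ_{t=1}^n t)
IsAffinePerm : ℕ → (ℤ → ℤ) → Set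
IsAffinePerm n w =
  Bijective _≡_ _≡_ w
  × (∀ i → w (i + + n) ≡ w i + + n)
  × sumFrom1 w n ≡ sumFrom1 (λ t → t) n

Avoids321 : (ℤ → ℤ) → Set
Avoids321 w = ¬ (∃ λ a → ∃ λ b → ∃ λ c →
  a < b × b < c × w b < w a × w c < w b)

CongMod : ℕ → ℤ → ℤ → Set
CongMod n a b = (+ n) ∣ (a - b)

union : ∀ {k} → (Fin k → List ℤ) → List ℤ
union X = concat (tabulate X)

-- A family X_1,...,X_k (each X_i given as a list of its elements) as in the
-- definition of d_k(w): no two listed integers (within or across the X_i)
-- are congruent mod n (this also forces disjointness and no repetitions), and
-- each X_i is decreasing for w.
Admissible : ℕ → (ℤ → ℤ) → (k : ℕ) → (Fin k → List ℤ) → Set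
Admissible n w k X =
  AllPairs (λ a b → ¬ CongMod n a b) (union X)
  × (∀ i u v → u ∈ X i → v ∈ X i → u < v → w v < w u)

size : ∀ {k} → (Fin k → List ℤ) → ℕ
size X = length (union X)

{-# OPTIONS --safe #-}
-- (i) Three distinct elements of a w-decreasing set, listed in increasing order, form a 321
-- pattern. (ii) The displacement w x − x is n-periodic but strictly decreases along an inversion,
-- so the entries of a 321 pattern are pairwise incongruent mod n and the pattern is itself an
-- admissible X₁ of size 3. As ¬ Avoids321 w yields a pattern only up to double negation, one is
-- found by a finite search: the periodic displacement is bounded, so every pattern translates to
-- one with middle entry in [0, n) and outer entries within a fixed distance of it.
module Submission where

open import Defs
open import Data.Nat using (ℕ; _≤_)
open import Data.Integer using (ℤ)
open import Data.Fin using (Fin)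
open import Data.List using (List; length)
open import Data.Product using (_×_; ∃)
open import Relation.Nullary using (¬_)

open import Data.Nat as ℕ using (zero; suc; z≤n; s≤s; NonZero)
open import Data.Integer as ℤ using (+_; -[1+_]; 0ℤ; _+_; _-_; -_; _*_; _<_; ∣_∣; +≤+; +<+)
open import Data.Integer.DivMod using (_%ℕ_; _/ℕ_; n%ℕd<d; a≡a%ℕn+[a/ℕn]*n)
open import Data.Integer.Divisibility using (_∣_)
open import Data.Integer.Divisibility.Signed using (divides; ∣ᵤ⇒∣)
open import Data.Nat.Divisibility using (_∣0)
open import Data.Integer.Properties
  using ( +-identityʳ; +-assoc; +-inverseʳ; neg-distribˡ-*; neg-mono-<; +-mono-<; +-monoˡ-<
        ; +-monoʳ-≤; <⇒≤; ≤-<-trans; <-trans; <-irrefl; <-asym; <-cmp; _<?_; i≤i+j; i≤j⇒0≤j-i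
        ; 0≤i⇒+∣i∣≡i; drop‿+<+; ≤-totalOrder; module ≤-Reasoning)
open import Data.Integer.Tactic.RingSolver using (solve-∀)
open import Data.Fin using (toℕ; fromℕ<)
open import Data.Fin.Properties using (any?; toℕ-fromℕ<)
open import Data.List using ([]; _∷_; _++_; concat; tabulate; applyUpTo)
open import Data.List.Extrema ≤-totalOrder using (min; max; min≤xs; xs≤max)
open import Data.List.Membership.Propositional using (_∈_)
open import Data.List.Membership.Propositional.Properties using (∈-applyUpTo⁺)
open import Data.List.Relation.Unary.All as All using (All; []; _∷_)
open import Data.List.Relation.Unary.All.Properties using (++⁻ˡ; tabulate⁻)
open import Data.List.Relation.Unary.AllPairs as AllPairs using (AllPairs; []; _∷_)
open import Data.List.Relation.Unary.Any using (here; there)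
open import Data.List.Relation.Unary.Unique.Propositional using (Unique)
open import Data.Product using (_,_; proj₁; proj₂; map₁)
open import Data.Empty using (⊥-elim)
open import Function using (_∘_)
open import Relation.Binary using (tri<; tri≈; tri>)
open import Relation.Binary.PropositionalEquality
  using (_≡_; _≢_; refl; sym; trans; cong; subst; subst₂; module ≡-Reasoning)
open import Relation.Nullary using (Dec)
open import Relation.Nullary.Decidable using (map′; _×-dec_; decidable-stable)

i+[j-i]≡j : ∀ i j → i + (j - i) ≡ j
i+[j-i]≡j = solve-∀

[i+j]-j≡i : ∀ i j → (i + j) - j ≡ i
[i+j]-j≡i = solve-∀

[i+k]-[j+k]≡i-j : ∀ i j k → (i + k) - (j + k) ≡ i - j
[i+k]-[j+k]≡i-j = solve-∀

[i+k]+[j-i]≡j+k : ∀ i j k → (i + k) + (j - i) ≡ j + k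
[i+k]+[j-i]≡j+k = solve-∀

i+[1+k]*n≡[i+k*n]+n : ∀ i k n → i + (+ 1 + k) * n ≡ (i + k * n) + n
i+[1+k]*n≡[i+k*n]+n = solve-∀

[i-k*n]+k*n≡i : ∀ i k n → (i + (- k) * n) + k * n ≡ i
[i-k*n]+k*n≡i = solve-∀

module _ {a r} {A : Set a} {R : A → A → Set r} where

  AllPairs-++⁻ : ∀ xs {ys} → AllPairs R (xs ++ ys) → AllPairs R xs × AllPairs R ys
  AllPairs-++⁻ []       Rys        = [] , Rys
  AllPairs-++⁻ (_ ∷ xs) (Rx ∷ Rxs) = map₁ (++⁻ˡ xs Rx ∷_) (AllPairs-++⁻ xs Rxs)

  AllPairs-concat⁻ : ∀ xss → AllPairs R (concat xss) → All (AllPairs R) xss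
  AllPairs-concat⁻ []         _  = []
  AllPairs-concat⁻ (xs ∷ xss) Rs with AllPairs-++⁻ xs Rs
  ... | Rxs , Rxss = Rxs ∷ AllPairs-concat⁻ xss Rxss

ascending-triple : ∀ {p} (P : ℤ → Set p) {x y z} → P x → P y → P z → x ≢ y → x ≢ z → y ≢ z →
                   ∃ λ a → ∃ λ b → ∃ λ c → a < b × b < c × P a × P b × P c
ascending-triple P {x} {y} {z} px py pz x≢y x≢z y≢z with <-cmp x y | <-cmp y z | <-cmp x z
... | tri≈ _ x≡y _ | _            | _            = ⊥-elim (x≢y x≡y)
... | _            | tri≈ _ y≡z _ | _            = ⊥-elim (y≢z y≡z)
... | _            | _            | tri≈ _ x≡z _ = ⊥-elim (x≢z x≡z)
... | tri< x<y _ _ | tri< y<z _ _ | _            = x , y , z , x<y , y<z , px , py , pz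
... | tri< x<y _ _ | tri> _ _ z<y | tri< x<z _ _ = x , z , y , x<z , z<y , px , pz , py
... | tri< x<y _ _ | tri> _ _ z<y | tri> _ _ z<x = z , x , y , z<x , x<y , pz , px , py
... | tri> _ _ y<x | tri< y<z _ _ | tri< x<z _ _ = y , x , z , y<x , x<z , py , px , pz
... | tri> _ _ y<x | tri< y<z _ _ | tri> _ _ z<x = y , z , x , y<z , z<x , py , pz , px
... | tri> _ _ y<x | tri> _ _ z<y | _            = z , y , x , z<y , y<x , pz , py , px

_∈[_,_⟩ : ℤ → ℤ → ℤ → Set
x ∈[ lo , hi ⟩ = lo ℤ.≤ x × x < hi

∃-in-interval? : ∀ {p} {P : ℤ → Set p} → (∀ x → Dec (P x)) → ∀ lo hi →
                 Dec (∃ λ x → x ∈[ lo , hi ⟩ × P x)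
∃-in-interval? {P = P} P? lo hi =
  map′ fromIndex toIndex (any? λ (i : Fin ∣ hi - lo ∣) → (lo + + toℕ i <? hi) ×-dec P? (lo + + toℕ i))
  where
  fromIndex : (∃ λ (i : Fin ∣ hi - lo ∣) → lo + + toℕ i < hi × P (lo + + toℕ i)) →
              ∃ λ x → x ∈[ lo , hi ⟩ × P x
  fromIndex (i , x<hi , px) = lo + + toℕ i , (i≤i+j lo (+ toℕ i) , x<hi) , px

  toIndex : (∃ λ x → x ∈[ lo , hi ⟩ × P x) →
            ∃ λ (i : Fin ∣ hi - lo ∣) → lo + + toℕ i < hi × P (lo + + toℕ i)
  toIndex (x , (lo≤x , x<hi) , px) =
    fromℕ< offset<width , subst (λ y → y < hi × P y) (sym lo+offset≡x) (x<hi , px)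
    where
    offset≡x-lo : + ∣ x - lo ∣ ≡ x - lo
    offset≡x-lo = 0≤i⇒+∣i∣≡i (i≤j⇒0≤j-i lo≤x)

    offset<width : ∣ x - lo ∣ ℕ.< ∣ hi - lo ∣
    offset<width = drop‿+<+ (begin-strict
      + ∣ x - lo ∣   ≡⟨ offset≡x-lo ⟩
      x - lo         <⟨ +-monoˡ-< (- lo) x<hi ⟩
      hi - lo        ≡⟨ sym (0≤i⇒+∣i∣≡i (i≤j⇒0≤j-i (<⇒≤ (≤-<-trans lo≤x x<hi)))) ⟩
      + ∣ hi - lo ∣  ∎)
      where open ≤-Reasoning

    lo+offset≡x : lo + + toℕ (fromℕ< offset<width) ≡ x
    lo+offset≡x = begin
      lo + + toℕ (fromℕ< offset<width)  ≡⟨ cong (λ d → lo + + d) (toℕ-fromℕ< offset<width) ⟩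
      lo + + ∣ x - lo ∣                 ≡⟨ cong (_+_ lo) offset≡x-lo ⟩
      lo + (x - lo)                     ≡⟨ i+[j-i]≡j lo x ⟩
      x                                 ∎
      where open ≡-Reasoning

Periodic : ∀ {a} {A : Set a} → ℕ → (ℤ → A) → Set a
Periodic n f = ∀ x → f (x + + n) ≡ f x

module _ {a} {A : Set a} {n : ℕ} {f : ℤ → A} (f-periodic : Periodic n f) where
  open ≡-Reasoning

  periodic-+-ℕ-multiple : ∀ k x → f (x + + k * + n) ≡ f x
  periodic-+-ℕ-multiple zero    x = cong f (+-identityʳ x)
  periodic-+-ℕ-multiple (suc k) x = begin
    f (x + + suc k * + n)      ≡⟨ cong f (i+[1+k]*n≡[i+k*n]+n x (+ k) (+ n)) ⟩
    f ((x + + k * + n) + + n)  ≡⟨ f-periodic _ ⟩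
    f (x + + k * + n)          ≡⟨ periodic-+-ℕ-multiple k x ⟩
    f x                        ∎

  periodic-+-multiple : ∀ q x → f (x + q * + n) ≡ f x
  periodic-+-multiple (+ k)    x = periodic-+-ℕ-multiple k x
  periodic-+-multiple -[1+ k ] x = begin
    f y                    ≡⟨ sym (periodic-+-ℕ-multiple (suc k) y) ⟩
    f (y + + suc k * + n)  ≡⟨ cong f ([i-k*n]+k*n≡i x (+ suc k) (+ n)) ⟩
    f x                    ∎
    where y = x + -[1+ k ] * + n

  periodic-%ℕ : .{{_ : NonZero n}} → ∀ x → f x ≡ f (+ (x %ℕ n))
  periodic-%ℕ x = begin
    f x                              ≡⟨ cong f (a≡a%ℕn+[a/ℕn]*n x n) ⟩
    f (+ (x %ℕ n) + (x /ℕ n) * + n)  ≡⟨ periodic-+-multiple (x /ℕ n) _ ⟩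
    f (+ (x %ℕ n))                   ∎

BoundedBy : ℤ → ℤ → (ℤ → ℤ) → Set
BoundedBy L U f = ∀ x → L ℤ.≤ f x × f x ℤ.≤ U

periodic⇒bounded : ∀ {n} .{{_ : NonZero n}} {f : ℤ → ℤ} → Periodic n f → ∃ λ L → ∃ λ U → BoundedBy L U f
periodic⇒bounded {n} {f} f-periodic = L , U , bounded
  where
  values : List ℤ
  values = applyUpTo (f ∘ +_) n
  L = min (f 0ℤ) values
  U = max (f 0ℤ) values

  bounded : BoundedBy L U f
  bounded x = subst (λ y → L ℤ.≤ y × y ℤ.≤ U) (sym (periodic-%ℕ f-periodic x))
                (All.lookup (min≤xs _ values) residue∈ , All.lookup (xs≤max _ values) residue∈)
    where residue∈ = ∈-applyUpTo⁺ (f ∘ +_) (n%ℕd<d x n)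

displacement : (ℤ → ℤ) → ℤ → ℤ
displacement w x = w x - x

Inversion : (ℤ → ℤ) → ℤ → ℤ → Set
Inversion w u v = u < v × w v < w u

Pattern321 : (ℤ → ℤ) → ℤ → ℤ → ℤ → Set
Pattern321 w a b c = a < b × b < c × w b < w a × w c < w b

Contains321 : (ℤ → ℤ) → Set
Contains321 w = ∃ λ a → ∃ λ b → ∃ λ c → Pattern321 w a b c

Pattern321Within : ℕ → (ℤ → ℤ) → ℤ → Set
Pattern321Within n w D = ∃ λ b → b ∈[ 0ℤ , + n ⟩ ×
                         ∃ λ a → a ∈[ b - D , b ⟩ ×
                         ∃ λ c → c ∈[ b , b + D ⟩ × Pattern321 w a b c

Decreasing : (ℤ → ℤ) → List ℤ → Set
Decreasing w xs = ∀ u v → u ∈ xs → v ∈ xs → u < v → w v < w u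

pattern321? : ∀ w a b c → Dec (Pattern321 w a b c)
pattern321? w a b c = (a <? b) ×-dec (b <? c) ×-dec (w b <? w a) ×-dec (w c <? w b)

pattern321Within? : ∀ n w D → Dec (Pattern321Within n w D)
pattern321Within? n w D =
  ∃-in-interval? (λ b →
    ∃-in-interval? (λ a →
      ∃-in-interval? (λ c → pattern321? w a b c) b (b + D))
    (b - D) b)
  0ℤ (+ n)

within⇒contains321 : ∀ {n w D} → Pattern321Within n w D → Contains321 w
within⇒contains321 (b , _ , a , _ , c , _ , p) = a , b , c , p

pattern321⇒inversions : ∀ {w a b c} → Pattern321 w a b c → AllPairs (Inversion w) (a ∷ b ∷ c ∷ [])
pattern321⇒inversions (a<b , b<c , wb<wa , wc<wb) =
  ((a<b , wb<wa) ∷ (<-trans a<b b<c , <-trans wc<wb wb<wa) ∷ []) ∷ ((b<c , wc<wb) ∷ []) ∷ [] ∷ []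

inversions⇒decreasing : ∀ {w xs} → AllPairs (Inversion w) xs → Decreasing w xs
inversions⇒decreasing (_ ∷ _)      u v (here refl) (here refl) u<v = ⊥-elim (<-irrefl refl u<v)
inversions⇒decreasing (inv ∷ _)    u v (here refl) (there v∈) _    = proj₂ (All.lookup inv v∈)
inversions⇒decreasing (inv ∷ _)    u v (there u∈) (here refl) u<v  = ⊥-elim (<-asym u<v (proj₁ (All.lookup inv u∈)))
inversions⇒decreasing (_ ∷ invs)   u v (there u∈) (there v∈)       = inversions⇒decreasing invs u v u∈ v∈

inversion⇒displacement> : ∀ {w u v} → Inversion w u v → displacement w v < displacement w u
inversion⇒displacement> (u<v , wv<wu) = +-mono-< wv<wu (neg-mono-< u<v)

inversion-span : ∀ w {L U} → BoundedBy L U (displacement w) → ∀ {u v} → w v < w u → v < u + (U - L)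
inversion-span w {L} {U} bounded {u} {v} wv<wu = begin-strict
  v            ≡⟨ sym ([i+j]-j≡i v L) ⟩
  (v + L) - L  <⟨ +-monoˡ-< (- L) v+L<u+U ⟩
  (u + U) - L  ≡⟨ +-assoc u U (- L) ⟩
  u + (U - L)  ∎
  where
  open ≤-Reasoning
  v+L<u+U : v + L < u + U
  v+L<u+U = begin-strict
    v + L                 ≤⟨ +-monoʳ-≤ v (proj₁ (bounded v)) ⟩
    v + displacement w v  ≡⟨ i+[j-i]≡j v (w v) ⟩
    w v                   <⟨ wv<wu ⟩
    w u                   ≡⟨ sym (i+[j-i]≡j u (w u)) ⟩
    u + displacement w u  ≤⟨ +-monoʳ-≤ u (proj₂ (bounded u)) ⟩
    u + U                 ∎

avoids321⇒length≤2 : ∀ {w} → Avoids321 w → ∀ xs → Unique xs → Decreasing w xs → length xs ≤ 2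
avoids321⇒length≤2 avoids []           _ _ = z≤n
avoids321⇒length≤2 avoids (_ ∷ [])     _ _ = s≤s z≤n
avoids321⇒length≤2 avoids (_ ∷ _ ∷ []) _ _ = s≤s (s≤s z≤n)
avoids321⇒length≤2 avoids xs@(x ∷ y ∷ z ∷ _) ((x≢y ∷ x≢z ∷ _) ∷ (y≢z ∷ _) ∷ _) decreasing
  with ascending-triple (_∈ xs) (here refl) (there (here refl)) (there (there (here refl))) x≢y x≢z y≢z
... | a , b , c , a<b , b<c , a∈ , b∈ , c∈ =
  ⊥-elim (avoids (a , b , c , a<b , b<c , decreasing a b a∈ b∈ a<b , decreasing b c b∈ c∈ b<c))

congMod-refl : ∀ n x → CongMod n x x
congMod-refl n x = subst (+ n ∣_) (sym (+-inverseʳ x)) (n ∣0)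

incongruent⇒≢ : ∀ {n x y} → ¬ CongMod n x y → x ≢ y
incongruent⇒≢ {n} {x} incongruent refl = incongruent (congMod-refl n x)

blocks-unique : ∀ {n k} (X : Fin k → List ℤ) → AllPairs (λ a b → ¬ CongMod n a b) (union X) →
                ∀ i → Unique (X i)
blocks-unique X apart = tabulate⁻ (AllPairs-concat⁻ (tabulate X) (AllPairs.map incongruent⇒≢ apart))

module _ {n : ℕ} {w : ℤ → ℤ} (w-quasiperiodic : ∀ x → w (x + + n) ≡ w x + + n) where

  displacement-periodic : Periodic n (displacement w)
  displacement-periodic x = begin
    w (x + + n) - (x + + n)  ≡⟨ cong (_- (x + + n)) (w-quasiperiodic x) ⟩
    (w x + + n) - (x + + n)  ≡⟨ [i+k]-[j+k]≡i-j (w x) x (+ n) ⟩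
    w x - x                  ∎
    where open ≡-Reasoning

  w-+-multiple : ∀ q x → w (x + q * + n) ≡ w x + q * + n
  w-+-multiple q x = begin
    w (x + t)                         ≡⟨ sym (i+[j-i]≡j (x + t) _) ⟩
    (x + t) + displacement w (x + t)  ≡⟨ cong (_+_ (x + t)) (periodic-+-multiple displacement-periodic q x) ⟩
    (x + t) + (w x - x)               ≡⟨ [i+k]+[j-i]≡j+k x (w x) t ⟩
    w x + t                           ∎
    where
    open ≡-Reasoning
    t = q * + n

  congMod⇒displacement≡ : ∀ {u v} → CongMod n u v → displacement w u ≡ displacement w v
  congMod⇒displacement≡ {u} {v} n∣u-v with ∣ᵤ⇒∣ n∣u-v
  ... | divides q u-v≡q*n = begin
    displacement w u              ≡⟨ cong (displacement w) u≡v+q*n ⟩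
    displacement w (v + q * + n)  ≡⟨ periodic-+-multiple displacement-periodic q v ⟩
    displacement w v              ∎
    where
    open ≡-Reasoning
    u≡v+q*n : u ≡ v + q * + n
    u≡v+q*n = trans (sym (i+[j-i]≡j v u)) (cong (_+_ v) u-v≡q*n)

  inversion⇒incongruent : ∀ {u v} → Inversion w u v → ¬ CongMod n u v
  inversion⇒incongruent inv congruent = <-irrefl (sym (congMod⇒displacement≡ congruent)) (inversion⇒displacement> inv)

  contains321⇒admissible-triple : Contains321 w → ∃ λ (X : Fin 1 → List ℤ) → Admissible n w 1 X × 3 ≤ size X
  contains321⇒admissible-triple (a , b , c , p) =
    (λ _ → a ∷ b ∷ c ∷ []) ,
    (AllPairs.map inversion⇒incongruent inversions , λ _ → inversions⇒decreasing inversions) ,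
    s≤s (s≤s (s≤s z≤n))
    where inversions = pattern321⇒inversions p

  pattern321-translate : ∀ q {a b c} → Pattern321 w a b c →
                         Pattern321 w (a + q * + n) (b + q * + n) (c + q * + n)
  pattern321-translate q (a<b , b<c , wb<wa , wc<wb) =
    +-monoˡ-< t a<b , +-monoˡ-< t b<c , translate-inversion wb<wa , translate-inversion wc<wb
    where
    t = q * + n
    translate-inversion : ∀ {u v} → w v < w u → w (v + t) < w (u + t)
    translate-inversion {u} {v} wv<wu =
      subst₂ _<_ (sym (w-+-multiple q v)) (sym (w-+-multiple q u)) (+-monoˡ-< t wv<wu)

  module _ .{{_ : NonZero n}} where

    pattern321-centred : ∀ {a b c} → Pattern321 w a b c → ∃ λ a′ → ∃ λ c′ → Pattern321 w a′ (+ (b %ℕ n)) c′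
    pattern321-centred {a} {b} {c} p =
      a + t , c + t , subst (λ b′ → Pattern321 w (a + t) b′ (c + t)) b+t≡b%n (pattern321-translate q p)
      where
      open ≡-Reasoning
      q = - (b /ℕ n)
      t = q * + n
      b+t≡b%n : b + t ≡ + (b %ℕ n)
      b+t≡b%n = begin
        b + - (b /ℕ n) * + n                            ≡⟨ cong (_+_ b) (sym (neg-distribˡ-* (b /ℕ n) (+ n))) ⟩
        b - (b /ℕ n) * + n                              ≡⟨ cong (_- (b /ℕ n) * + n) (a≡a%ℕn+[a/ℕn]*n b n) ⟩
        (+ (b %ℕ n) + (b /ℕ n) * + n) - (b /ℕ n) * + n  ≡⟨ [i+j]-j≡i (+ (b %ℕ n)) ((b /ℕ n) * + n) ⟩
        + (b %ℕ n)                                      ∎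

    pattern321⇒within : ∀ {L U a b c} → BoundedBy L U (displacement w) → Pattern321 w a b c →
                        Pattern321Within n w (U - L)
    pattern321⇒within {L} {U} {b = b} bounded p with pattern321-centred p
    ... | a , c , p′@(a<r , r<c , wr<wa , wc<wr) =
      + (b %ℕ n) , (+≤+ z≤n , +<+ (n%ℕd<d b n)) ,
      a , (<⇒≤ r-D<a , a<r) ,
      c , (<⇒≤ r<c , inversion-span w bounded wc<wr) ,
      p′
      where
      open ≤-Reasoning
      r-D<a : + (b %ℕ n) - (U - L) < a
      r-D<a = begin-strict
        + (b %ℕ n) - (U - L)     <⟨ +-monoˡ-< (- (U - L)) (inversion-span w bounded wr<wa) ⟩
        (a + (U - L)) - (U - L)  ≡⟨ [i+j]-j≡i a (U - L) ⟩
        a                        ∎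

    ¬avoids321⇒contains321 : ¬ Avoids321 w → Contains321 w
    ¬avoids321⇒contains321 ¬avoids with periodic⇒bounded displacement-periodic
    ... | L , U , bounded = within⇒contains321 (decidable-stable (pattern321Within? n w (U - L)) ¬¬within)
      where
      ¬¬within : ¬ ¬ Pattern321Within n w (U - L)
      ¬¬within ¬within = ¬avoids (λ (a , b , c , p) → ¬within (pattern321⇒within bounded p))

lemma3p3 : (n : ℕ) → 3 ≤ n → (w : ℤ → ℤ) → IsAffinePerm n w →
    (Avoids321 w → (k : ℕ) → (X : Fin k → List ℤ) → Admissible n w k X →
      (i : Fin k) → length (X i) ≤ 2)
    × (¬ Avoids321 w →
      ∃ λ (X : Fin 1 → List ℤ) → Admissible n w 1 X × 3 ≤ size X)
lemma3p3 (suc _) (s≤s _) w (_ , w-quasiperiodic , _) =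
  (λ avoids k X (apart , decreasing) i →
    avoids321⇒length≤2 avoids (X i) (blocks-unique X apart i) (decreasing i)) ,
  contains321⇒admissible-triple w-quasiperiodic ∘ ¬avoids321⇒contains321 w-quasiperiodic
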